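{- Let $L$ be an extremal even unimodular lattice of rank $64$ and let $\Gamma$ be a subgroup of $\mathrm{O}(L)$. If there exists a $\Gamma$-rigidifying basis of $L$, then $\mathrm{O}(L)=\Gamma$.
   Context: $L$ is positive-definite with form $\langle\,,\rangle_L$; extremal of rank $64$ means the minimal nonzero norm is $6$. $\mathrm{Min}(L)=\{v\in L:\langle v,v\rangle_L=6\}$. For $v\in\mathrm{Min}(L)$ and $k\in\{1,2,3\}$ let $a_k(v)=\frac12\,|\{v'\in\mathrm{Min}(L):\langle v,v'\rangle_L=\pm k\}|$, and let $a(v)=[a_1(v),a_2(v),a_3(v)]$ (the intersection pattern of $v$). For a triple $a$ let $\mathcal{A}_L(a)=\{v\in\mathrm{Min}(L):a(v)=a\}$. An ordered list $(v_1,\dots,v_{64})$ of vectors in $\mathrm{Min}(L)$ is a $\Gamma$-rigidifying basis if: (a) $v_1,\dots,v_{64}$ form a basis of $L\otimes\mathbb{Q}$; (b) $\Gamma$ acts transitively on $\mathcal{A}_L(a(v_1))$; (c) for each $i>1$, the set $\{v'\in\mathcal{A}_L(a(v_i)):\langle v',v_j\rangle_L=\langle v_i,v_j\rangle_L \text{ for all } j<i\}$ consists of the single element $v_i$. -}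

module Defs where

open import Data.Nat as ℕ using (ℕ; zero; suc)
open import Data.Integer as ℤ using (ℤ; +_; -_)
open import Data.Integer.Divisibility using (_∣_)
import Data.Rational as ℚ
open import Data.Rational using (ℚ)
open import Data.Fin using (Fin; toℕ)
open import Data.Vec using (Vec; []; _∷_; map; zipWith; foldr; replicate; lookup; tabulate)
open import Data.Product using (Σ; _×_; ∃; ∃-syntax; _,_)
open import Data.Sum using (_⊎_)
open import Relation.Binary.PropositionalEquality using (_≡_; _≢_)
open import Function.Bundles using (_↔_)

-- Integer vectors / matrices.  A lattice of rank n is modelled as ℤⁿ
-- (coordinates w.r.t. a fixed ℤ-basis) together with its Gram matrix.

Vector : ℕ → Set
Vector n = Vec ℤ n

Matrix : ℕ → Set
Matrix n = Vec (Vec ℤ n) n   -- list of rows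

dot : ∀ {n} → Vector n → Vector n → ℤ
dot u v = foldr _ ℤ._+_ (+ 0) (zipWith ℤ._*_ u v)

_·_ : ∀ {n} → Matrix n → Vector n → Vector n
M · v = map (λ row → dot row v) M

column : ∀ {n} → Matrix n → Fin n → Vector n
column M j = map (λ row → lookup row j) M

_⊗_ : ∀ {n} → Matrix n → Matrix n → Matrix n
A ⊗ B = map (λ row → tabulate (λ j → dot row (column B j))) A

identity : ∀ {n} → Matrix n
identity = tabulate (λ i → tabulate (λ j → δ i j))
  where
  δ : ∀ {n} → Fin n → Fin n → ℤ
  δ Fin.zero    Fin.zero    = + 1
  δ Fin.zero    (Fin.suc _) = + 0
  δ (Fin.suc _) Fin.zero    = + 0
  δ (Fin.suc i) (Fin.suc j) = δ i j

zeroVec : ∀ {n} → Vector n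
zeroVec = replicate _ (+ 0)

transpose : ∀ {n} → Matrix n → Matrix n
transpose M = tabulate (λ i → column M i)

record Lattice (n : ℕ) : Set where
  field
    gram : Matrix n

  ⟨_,_⟩ : Vector n → Vector n → ℤ
  ⟨ u , v ⟩ = dot u (gram · v)

  norm : Vector n → ℤ
  norm v = ⟨ v , v ⟩

open Lattice public

IsPositiveDefinite : ∀ {n} → Lattice n → Set
IsPositiveDefinite {n} L =
  transpose (gram L) ≡ gram L × (∀ (v : Vector n) → v ≢ zeroVec → + 0 ℤ.< norm L v)

IsEven : ∀ {n} → Lattice n → Set
IsEven {n} L = ∀ (v : Vector n) → + 2 ∣ norm L v

-- unimodular: L = L^#, i.e. the Gram matrix is invertible over ℤ
IsUnimodular : ∀ {n} → Lattice n → Set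
IsUnimodular {n} L = Σ (Matrix n) λ H → (gram L ⊗ H ≡ identity) × (H ⊗ gram L ≡ identity)

IsExtremal64 : Lattice 64 → Set
IsExtremal64 L =
  (∀ (v : Vector 64) → v ≢ zeroVec → + 6 ℤ.≤ norm L v) × (∃[ v ] (v ≢ zeroVec × norm L v ≡ + 6))

IsExtremalEvenUnimodular64 : Lattice 64 → Set
IsExtremalEvenUnimodular64 L =
  IsPositiveDefinite L × IsEven L × IsUnimodular L × IsExtremal64 L

InMin : ∀ {n} → Lattice n → Vector n → Set
InMin L v = norm L v ≡ + 6

PairSet : ∀ {n} → Lattice n → Vector n → ℕ → Set
PairSet {n} L v k =
  Σ (Vector n) λ v' → InMin L v' × (⟨ L , v ⟩ v' ≡ + k ⊎ ⟨ L , v ⟩ v' ≡ - (+ k))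

HasCard : Set → ℕ → Set
HasCard S m = S ↔ Fin m

-- a_k(v) = m  (i.e. the set above has 2m elements)
aₖ≡ : ∀ {n} → Lattice n → ℕ → Vector n → ℕ → Set
aₖ≡ L k v m = HasCard (PairSet L v k) (2 ℕ.* m)

SamePattern : ∀ {n} → Lattice n → Vector n → Vector n → Set
SamePattern L v w =
  ∀ (k : ℕ) → 1 ℕ.≤ k → k ℕ.≤ 3 → ∃[ m ] (aₖ≡ L k v m × aₖ≡ L k w m)

In𝒜 : ∀ {n} → Lattice n → Vector n → Vector n → Set
In𝒜 L v v' = InMin L v' × SamePattern L v' v

IsIntInvertible : ∀ {n} → Matrix n → Set
IsIntInvertible {n} A = Σ (Matrix n) λ B → (A ⊗ B ≡ identity) × (B ⊗ A ≡ identity)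

InO : ∀ {n} → Lattice n → Matrix n → Set
InO {n} L A =
  IsIntInvertible A × (∀ (u v : Vector n) → ⟨ L , A · u ⟩ (A · v) ≡ ⟨ L , u ⟩ v)

IsSubgroupO : ∀ {n} → Lattice n → (Matrix n → Set) → Set
IsSubgroupO {n} L Γ =
  (∀ A → Γ A → InO L A)
  × Γ identity
  × (∀ A B → Γ A → Γ B → Γ (A ⊗ B))
  × (∀ A B → Γ A → A ⊗ B ≡ identity → B ⊗ A ≡ identity → Γ B)

toℚ : ∀ {n} → Vector n → Vec ℚ n
toℚ = map (ℚ._/ 1)

linComb : ∀ {n m} → Vec ℚ m → Vec (Vector n) m → Vec ℚ n
linComb {n} []       []       = replicate n ℚ.0ℚ
linComb {n} (c ∷ cs) (v ∷ vs) = zipWith ℚ._+_ (map (c ℚ.*_) (toℚ v)) (linComb cs vs)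

IsℚBasis : ∀ {n} → Vec (Vector n) n → Set
IsℚBasis {n} vs =
  (∀ (c : Vec ℚ n) → linComb c vs ≡ replicate n ℚ.0ℚ → c ≡ replicate n ℚ.0ℚ)
  × (∀ (w : Vec ℚ n) → ∃[ c ] (linComb c vs ≡ w))

TransitiveOn𝒜 : ∀ {n} → Lattice n → (Matrix n → Set) → Vector n → Set
TransitiveOn𝒜 L Γ v =
  ∀ w w' → In𝒜 L v w → In𝒜 L v w' → ∃[ A ] (Γ A × A · w ≡ w')

-- (v₁,…,vₙ) (0-indexed here as vs[0..n-1]) is a Γ-rigidifying basis
IsRigidifyingBasis : ∀ {n} → Lattice n → (Matrix n → Set) → Vec (Vector n) n → Set
IsRigidifyingBasis {n} L Γ vs =
  (∀ i → InMin L (lookup vs i))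
  × IsℚBasis vs
  × (∀ (i : Fin n) → toℕ i ≡ 0 → TransitiveOn𝒜 L Γ (lookup vs i))
  × (∀ (i : Fin n) → 1 ℕ.≤ toℕ i →
       ∀ v' → In𝒜 L (lookup vs i) v' →
       (∀ (j : Fin n) → toℕ j ℕ.< toℕ i → ⟨ L , v' ⟩ (lookup vs j) ≡ ⟨ L , lookup vs i ⟩ (lookup vs j)) →
       v' ≡ lookup vs i)

-- Let A ∈ O(L). Since A preserves intersection patterns, A v₁ ∈ 𝒜_L(a(v₁)), so by (b) some
-- γ ∈ Γ has γ v₁ = A v₁. The isometry φ = γ⁻¹A fixes v₁, and then every vᵢ by induction:
-- φ vᵢ has the pattern of vᵢ and the same products with v₁, …, vᵢ₋₁, so (c) gives φ vᵢ = vᵢ.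
-- For every e, φ e − e is orthogonal to the ℚ-basis, hence has norm 0 and vanishes by
-- definiteness; so A = γ ∈ Γ. For patterns to be defined at all, Min(L) must be finite: the
-- coordinates of a minimal vector are its products with the rows of the inverse Gram matrix,
-- bounded by Cauchy–Schwarz.

module Submission where

open import Defs
open import Level using (0ℓ)
open import Data.Nat as ℕ using (ℕ; zero; suc; z≤n; s≤s)
import Data.Nat.Properties as ℕ
import Data.Nat.Coprimality as Coprimality
open import Data.Integer as ℤ using (ℤ; +_; -_; -[1+_]; _+_; _*_; _-_; _≤_; _<_; ∣_∣)
import Data.Integer.Properties as ℤ
open import Data.Integer.Tactic.RingSolver using (solve-∀)
import Data.Rational as ℚ
open import Data.Rational using (ℚ; mkℚ; 0ℚ)
import Data.Rational.Properties as ℚ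
open import Data.Rational.Solver using (module +-*-Solver)
open import Data.Fin using (Fin)
import Data.Fin as Fin
import Data.Fin.Properties as Fin
import Data.Fin.Induction as Fin
open import Data.Vec using (Vec; []; _∷_; map; zipWith; replicate; lookup; tabulate)
import Data.Vec.Properties as Vec
open import Data.List as List using (List; _∷_; _++_; [_]; upTo; filter; deduplicate; cartesianProductWith; length)
open import Data.List.Relation.Unary.Any using (here; there; index)
open import Data.List.Membership.Propositional using (_∈_)
open import Data.List.Membership.Propositional.Properties
  using (∈-lookup; ∈-++⁺ˡ; ∈-++⁺ʳ; ∈-map⁺; ∈-upTo⁺; ∈-cartesianProductWith⁺; ∈-filter⁺; ∈-filter⁻; ∈-deduplicate⁺; ∈-deduplicate⁻)
open import Data.List.Membership.Propositional.Properties.WithK using (unique⇒irrelevant)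
import Data.List.Relation.Unary.Unique.DecPropositional.Properties as Unique
open import Data.Product using (Σ; _×_; ∃-syntax; _,_; proj₁; proj₂)
open import Data.Product.Function.Dependent.Propositional using (Σ-↔)
open import Data.Sum using (_⊎_)
open import Data.Sum.Function.Propositional using (_⊎-↔_)
open import Function using (_∘_)
open import Function.Bundles using (_↔_; Inverse; mk↔ₛ′)
open import Function.Properties.Inverse using (↔-refl; ↔-sym; ↔-trans)
open import Function.Related.TypeIsomorphisms using (Σ-distribˡ-⊎; ×-distribˡ-⊎)
open import Induction.WellFounded using (module All)
open import Relation.Binary.Definitions using (DecidableEquality)
open import Relation.Binary.PropositionalEquality hiding ([_])
open import Relation.Binary.PropositionalEquality.WithK using (≡-irrelevant)
open import Relation.Nullary using (yes; no; contradiction)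
open import Relation.Nullary.Decidable using (_×-dec_)
open import Relation.Nullary.Irrelevant using (Irrelevant)
import Relation.Unary as Pred
open ≡-Reasoning

infixl 6 _+ᵥ_ _-ᵥ_
infixl 7 _*ᵥ_

_+ᵥ_ : ∀ {n} → Vector n → Vector n → Vector n
_+ᵥ_ = zipWith _+_

_*ᵥ_ : ∀ {n} → ℤ → Vector n → Vector n
c *ᵥ v = map (c *_) v

-ᵥ_ : ∀ {n} → Vector n → Vector n
-ᵥ_ = (- + 1) *ᵥ_

_-ᵥ_ : ∀ {n} → Vector n → Vector n → Vector n
u -ᵥ w = u +ᵥ -ᵥ w

dot-distribʳ-+ᵥ : ∀ {n} (u v w : Vector n) → dot u (v +ᵥ w) ≡ dot u v + dot u w
dot-distribʳ-+ᵥ []      []      []      = refl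
dot-distribʳ-+ᵥ (x ∷ u) (a ∷ v) (b ∷ w) =
  trans (cong (_+_ (x * (a + b))) (dot-distribʳ-+ᵥ u v w)) (shuffle x a b (dot u v) (dot u w))
  where
  shuffle : ∀ x a b r s → x * (a + b) + (r + s) ≡ (x * a + r) + (x * b + s)
  shuffle = solve-∀

dot-distribˡ-+ᵥ : ∀ {n} (u v w : Vector n) → dot (u +ᵥ v) w ≡ dot u w + dot v w
dot-distribˡ-+ᵥ []      []      []      = refl
dot-distribˡ-+ᵥ (a ∷ u) (b ∷ v) (x ∷ w) =
  trans (cong (_+_ ((a + b) * x)) (dot-distribˡ-+ᵥ u v w)) (shuffle a b x (dot u w) (dot v w))
  where
  shuffle : ∀ a b x r s → (a + b) * x + (r + s) ≡ (a * x + r) + (b * x + s)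
  shuffle = solve-∀

dot-*ᵥʳ : ∀ {n} c (u v : Vector n) → dot u (c *ᵥ v) ≡ c * dot u v
dot-*ᵥʳ c []      []      = sym (ℤ.*-zeroʳ c)
dot-*ᵥʳ c (x ∷ u) (a ∷ v) =
  trans (cong (_+_ (x * (c * a))) (dot-*ᵥʳ c u v)) (factor c x a (dot u v))
  where
  factor : ∀ c x a r → x * (c * a) + c * r ≡ c * (x * a + r)
  factor = solve-∀

dot-*ᵥˡ : ∀ {n} c (u v : Vector n) → dot (c *ᵥ u) v ≡ c * dot u v
dot-*ᵥˡ c []      []      = sym (ℤ.*-zeroʳ c)
dot-*ᵥˡ c (a ∷ u) (x ∷ v) =
  trans (cong (_+_ (c * a * x)) (dot-*ᵥˡ c u v)) (factor c a x (dot u v))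
  where
  factor : ∀ c a x r → c * a * x + c * r ≡ c * (a * x + r)
  factor = solve-∀

dot-comm : ∀ {n} (u v : Vector n) → dot u v ≡ dot v u
dot-comm []      []      = refl
dot-comm (x ∷ u) (y ∷ v) = cong₂ _+_ (ℤ.*-comm x y) (dot-comm u v)

dot-zeroˡ : ∀ {n} (v : Vector n) → dot zeroVec v ≡ + 0
dot-zeroˡ []      = refl
dot-zeroˡ (x ∷ v) = trans (ℤ.+-identityˡ _) (dot-zeroˡ v)

-1*-involutive : ∀ x → - + 1 * (- + 1 * x) ≡ x
-1*-involutive = solve-∀

-1*i≡-i : ∀ x → - + 1 * x ≡ - x
-1*i≡-i = solve-∀

-ᵥ-involutive : ∀ {n} (v : Vector n) → -ᵥ -ᵥ v ≡ v
-ᵥ-involutive []      = refl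
-ᵥ-involutive (x ∷ v) = cong₂ _∷_ (-1*-involutive x) (-ᵥ-involutive v)

-ᵥ↔ : ∀ {n} → Vector n ↔ Vector n
-ᵥ↔ = mk↔ₛ′ -ᵥ_ -ᵥ_ -ᵥ-involutive -ᵥ-involutive

u-ᵥv≡0⇒u≡v : ∀ {n} (u v : Vector n) → u -ᵥ v ≡ zeroVec → u ≡ v
u-ᵥv≡0⇒u≡v []      []      _  = refl
u-ᵥv≡0⇒u≡v (x ∷ u) (y ∷ v) eq =
  cong₂ _∷_ (ℤ.i-j≡0⇒i≡j x y (trans (minus x y) (Vec.∷-injectiveˡ eq)))
            (u-ᵥv≡0⇒u≡v u v (Vec.∷-injectiveʳ eq))
  where
  minus : ∀ x y → x - y ≡ x + - + 1 * y
  minus = solve-∀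

lookup-ext : ∀ {A : Set} {n} {xs ys : Vec A n} → (∀ i → lookup xs i ≡ lookup ys i) → xs ≡ ys
lookup-ext {xs = xs} {ys} eq =
  trans (sym (Vec.tabulate∘lookup xs)) (trans (Vec.tabulate-cong eq) (Vec.tabulate∘lookup ys))

tabulate-zero : ∀ {n} → tabulate {n = n} (λ _ → + 0) ≡ zeroVec
tabulate-zero {zero}  = refl
tabulate-zero {suc n} = cong (+ 0 ∷_) tabulate-zero

vecMat : ∀ {p q} → Vec ℤ p → Vec (Vec ℤ q) p → Vec ℤ q
vecMat a B = tabulate λ j → dot a (map (λ r → lookup r j) B)

vecMat-∷ : ∀ {p q} x (a : Vec ℤ p) (r : Vec ℤ q) B → vecMat (x ∷ a) (r ∷ B) ≡ x *ᵥ r +ᵥ vecMat a B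
vecMat-∷ x a r B = lookup-ext λ j → begin
  lookup (vecMat (x ∷ a) (r ∷ B)) j
    ≡⟨ Vec.lookup∘tabulate (λ j → x * lookup r j + dot a (map (λ r → lookup r j) B)) j ⟩
  x * lookup r j + dot a (map (λ r → lookup r j) B)
    ≡⟨ cong₂ _+_ (Vec.lookup-map j (x *_) r) (Vec.lookup∘tabulate (λ j → dot a (map (λ r → lookup r j) B)) j) ⟨
  lookup (x *ᵥ r) j + lookup (vecMat a B) j
    ≡⟨ Vec.lookup-zipWith _+_ j (x *ᵥ r) (vecMat a B) ⟨
  lookup (x *ᵥ r +ᵥ vecMat a B) j ∎

dot-vecMat : ∀ {p q} (a : Vec ℤ p) (B : Vec (Vec ℤ q) p) (w : Vec ℤ q) →
  dot (vecMat a B) w ≡ dot a (map (λ r → dot r w) B)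
dot-vecMat []      []      w = trans (cong (λ z → dot z w) tabulate-zero) (dot-zeroˡ w)
dot-vecMat (x ∷ a) (r ∷ B) w = begin
  dot (vecMat (x ∷ a) (r ∷ B)) w              ≡⟨ cong (λ z → dot z w) (vecMat-∷ x a r B) ⟩
  dot (x *ᵥ r +ᵥ vecMat a B) w                ≡⟨ dot-distribˡ-+ᵥ (x *ᵥ r) (vecMat a B) w ⟩
  dot (x *ᵥ r) w + dot (vecMat a B) w         ≡⟨ cong₂ _+_ (dot-*ᵥˡ x r w) (dot-vecMat a B w) ⟩
  x * dot r w + dot a (map (λ r → dot r w) B) ∎

⊗-· : ∀ {n} (A B : Matrix n) (w : Vector n) → (A ⊗ B) · w ≡ A · (B · w)
⊗-· A B w = trans (sym (Vec.map-∘ (λ r → dot r w) (λ r → vecMat r B) A))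
                  (Vec.map-cong (λ r → dot-vecMat r B w) A)

·-distrib-+ᵥ : ∀ {n} (M : Matrix n) (u v : Vector n) → M · (u +ᵥ v) ≡ M · u +ᵥ M · v
·-distrib-+ᵥ M u v = go M
  where
  go : ∀ {m} (rows : Vec (Vector _) m) →
       map (λ r → dot r (u +ᵥ v)) rows ≡ map (λ r → dot r u) rows +ᵥ map (λ r → dot r v) rows
  go []       = refl
  go (r ∷ rs) = cong₂ _∷_ (dot-distribʳ-+ᵥ r u v) (go rs)

·-*ᵥ : ∀ {n} (M : Matrix n) c (v : Vector n) → M · (c *ᵥ v) ≡ c *ᵥ (M · v)
·-*ᵥ M c v = go M
  where
  go : ∀ {m} (rows : Vec (Vector _) m) → map (λ r → dot r (c *ᵥ v)) rows ≡ c *ᵥ map (λ r → dot r v) rows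
  go []       = refl
  go (r ∷ rs) = cong₂ _∷_ (dot-*ᵥʳ c r v) (go rs)

identity-suc : ∀ {n} → identity {suc n} ≡ (+ 1 ∷ zeroVec) ∷ map (+ 0 ∷_) identity
identity-suc = cong₂ _∷_ (cong (+ 1 ∷_) tabulate-zero) (Vec.tabulate-∘ (+ 0 ∷_) _)

identity-· : ∀ {n} (w : Vector n) → identity · w ≡ w
identity-· []      = refl
identity-· (x ∷ w) = begin
  identity · (x ∷ w)
    ≡⟨ cong (_· (x ∷ w)) identity-suc ⟩
  (+ 1 * x + dot zeroVec w) ∷ map (λ r → dot r (x ∷ w)) (map (+ 0 ∷_) identity)
    ≡⟨ cong₂ _∷_ first (sym (Vec.map-∘ (λ r → dot r (x ∷ w)) (+ 0 ∷_) identity)) ⟩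
  x ∷ map (λ r → + 0 * x + dot r w) identity
    ≡⟨ cong (x ∷_) (Vec.map-cong (λ r → ℤ.+-identityˡ (dot r w)) identity) ⟩
  x ∷ identity · w
    ≡⟨ cong (x ∷_) (identity-· w) ⟩
  x ∷ w ∎
  where
  first : + 1 * x + dot zeroVec w ≡ x
  first = trans (cong (_+_ (+ 1 * x)) (dot-zeroˡ w)) (trans (ℤ.+-identityʳ _) (ℤ.*-identityˡ x))

inverse-cancel : ∀ {n} (M N : Matrix n) → M ⊗ N ≡ identity → ∀ w → M · (N · w) ≡ w
inverse-cancel M N MN≡I w = begin
  M · (N · w)    ≡⟨ ⊗-· M N w ⟨
  (M ⊗ N) · w    ≡⟨ cong (_· w) MN≡I ⟩
  identity · w   ≡⟨ identity-· w ⟩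
  w              ∎

unit : ∀ {n} → Fin n → Vector n
unit Fin.zero    = + 1 ∷ zeroVec
unit (Fin.suc j) = + 0 ∷ unit j

dot-unitʳ : ∀ {n} (r : Vector n) (j : Fin n) → dot r (unit j) ≡ lookup r j
dot-unitʳ (x ∷ r) Fin.zero    = trans (cong (_+_ (x * + 1)) (dot-zeroʳ r)) (trans (ℤ.+-identityʳ _) (ℤ.*-identityʳ x))
  where
  dot-zeroʳ : ∀ {n} (r : Vector n) → dot r zeroVec ≡ + 0
  dot-zeroʳ r = trans (dot-comm r zeroVec) (dot-zeroˡ r)
dot-unitʳ (x ∷ r) (Fin.suc j) = trans (cong (_+ dot r (unit j)) (ℤ.*-zeroʳ x)) (trans (ℤ.+-identityˡ _) (dot-unitʳ r j))

entry-via-unit : ∀ {n} (M : Matrix n) i j → lookup (lookup M i) j ≡ lookup (M · unit j) i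
entry-via-unit M i j = trans (sym (dot-unitʳ (lookup M i) j)) (sym (Vec.lookup-map i (λ r → dot r (unit j)) M))

matrix-ext : ∀ {n} (M N : Matrix n) → (∀ v → M · v ≡ N · v) → M ≡ N
matrix-ext M N M≗N = lookup-ext λ i → lookup-ext λ j → begin
  lookup (lookup M i) j   ≡⟨ entry-via-unit M i j ⟩
  lookup (M · unit j) i   ≡⟨ cong (λ v → lookup v i) (M≗N (unit j)) ⟩
  lookup (N · unit j) i   ≡⟨ entry-via-unit N i j ⟨
  lookup (lookup N i) j   ∎

module _ {n} (L : Lattice n) where

  ⟨⟩-distribʳ-+ᵥ : ∀ u v w → ⟨ L , u ⟩ (v +ᵥ w) ≡ ⟨ L , u ⟩ v + ⟨ L , u ⟩ w
  ⟨⟩-distribʳ-+ᵥ u v w = trans (cong (dot u) (·-distrib-+ᵥ (gram L) v w)) (dot-distribʳ-+ᵥ u _ _)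

  ⟨⟩-distribˡ-+ᵥ : ∀ u v w → ⟨ L , u +ᵥ v ⟩ w ≡ ⟨ L , u ⟩ w + ⟨ L , v ⟩ w
  ⟨⟩-distribˡ-+ᵥ u v w = dot-distribˡ-+ᵥ u v (gram L · w)

  ⟨⟩-*ᵥʳ : ∀ c u v → ⟨ L , u ⟩ (c *ᵥ v) ≡ c * ⟨ L , u ⟩ v
  ⟨⟩-*ᵥʳ c u v = trans (cong (dot u) (·-*ᵥ (gram L) c v)) (dot-*ᵥʳ c u _)

  ⟨⟩-*ᵥˡ : ∀ c u v → ⟨ L , c *ᵥ u ⟩ v ≡ c * ⟨ L , u ⟩ v
  ⟨⟩-*ᵥˡ c u v = dot-*ᵥˡ c u (gram L · v)

  ⟨⟩-sym : transpose (gram L) ≡ gram L → ∀ u v → ⟨ L , u ⟩ v ≡ ⟨ L , v ⟩ u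
  ⟨⟩-sym Gᵀ≡G u v = begin
    dot u (G · v)                                 ≡⟨ dot-vecMat u G v ⟨
    dot (tabulate λ j → dot u (column G j)) v     ≡⟨ cong (λ r → dot r v) (Vec.tabulate-cong λ j → dot-comm u (column G j)) ⟩
    dot (tabulate λ j → dot (column G j) u) v     ≡⟨ cong (λ r → dot r v) (Vec.tabulate-∘ (λ r → dot r u) (column G)) ⟩
    dot (transpose G · u) v                       ≡⟨ cong (λ M → dot (M · u) v) Gᵀ≡G ⟩
    dot (G · u) v                                 ≡⟨ dot-comm (G · u) v ⟩
    dot v (G · u)                                 ∎
    where G = gram L

  norm-+ᵥ-*ᵥ : ∀ a b u v → norm L (a *ᵥ u +ᵥ b *ᵥ v) ≡
    a * (a * ⟨ L , u ⟩ u + b * ⟨ L , u ⟩ v) + b * (a * ⟨ L , v ⟩ u + b * ⟨ L , v ⟩ v)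
  norm-+ᵥ-*ᵥ a b u v = begin
    ⟨ L , a *ᵥ u +ᵥ b *ᵥ v ⟩ w
      ≡⟨ ⟨⟩-distribˡ-+ᵥ (a *ᵥ u) (b *ᵥ v) w ⟩
    ⟨ L , a *ᵥ u ⟩ w + ⟨ L , b *ᵥ v ⟩ w
      ≡⟨ cong₂ _+_ (⟨⟩-*ᵥˡ a u w) (⟨⟩-*ᵥˡ b v w) ⟩
    a * ⟨ L , u ⟩ w + b * ⟨ L , v ⟩ w
      ≡⟨ cong₂ (λ s t → a * s + b * t) (expand u) (expand v) ⟩
    a * (a * ⟨ L , u ⟩ u + b * ⟨ L , u ⟩ v) + b * (a * ⟨ L , v ⟩ u + b * ⟨ L , v ⟩ v) ∎
    where
    w = a *ᵥ u +ᵥ b *ᵥ v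
    expand : ∀ x → ⟨ L , x ⟩ w ≡ a * ⟨ L , x ⟩ u + b * ⟨ L , x ⟩ v
    expand x = trans (⟨⟩-distribʳ-+ᵥ x _ _) (cong₂ _+_ (⟨⟩-*ᵥʳ a x u) (⟨⟩-*ᵥʳ b x v))

  coordinate-via-inverse : ∀ (H : Matrix n) → H ⊗ gram L ≡ identity → ∀ v i → lookup v i ≡ ⟨ L , lookup H i ⟩ v
  coordinate-via-inverse H HG≡I v i = begin
    lookup v i                     ≡⟨ cong (λ x → lookup x i) (inverse-cancel H (gram L) HG≡I v) ⟨
    lookup (H · (gram L · v)) i    ≡⟨ Vec.lookup-map i (λ r → dot r (gram L · v)) H ⟩
    ⟨ L , lookup H i ⟩ v           ∎

module _ {n} {L : Lattice n} (pd : IsPositiveDefinite L) where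

  norm-nonneg : ∀ v → + 0 ≤ norm L v
  norm-nonneg v with Vec.≡-dec ℤ._≟_ v zeroVec
  ... | yes refl = ℤ.≤-reflexive (sym (dot-zeroˡ (gram L · zeroVec)))
  ... | no v≢0   = ℤ.<⇒≤ (proj₂ pd v v≢0)

  -- Expand 0 ≤ ⟨b u - x v, b u - x v⟩ with x = ⟨u,v⟩ and b = ⟨v,v⟩, then cancel b.
  cauchy-schwarz : ∀ u v → + 0 < norm L v → ⟨ L , u ⟩ v * ⟨ L , u ⟩ v ≤ norm L u * norm L v
  cauchy-schwarz u v 0<b =
    ℤ.0≤i-j⇒j≤i (ℤ.*-cancelˡ-≤-pos (+ 0) (a * b - x * x) b ⦃ ℤ.positive 0<b ⦄
      (subst₂ _≤_ (sym (ℤ.*-zeroʳ b)) expansion (norm-nonneg (b *ᵥ u +ᵥ (- x) *ᵥ v))))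
    where
    x = ⟨ L , u ⟩ v
    a = norm L u
    b = norm L v
    collect : ∀ a b x → b * (b * a + - x * x) + - x * (b * x + - x * b) ≡ b * (a * b - x * x)
    collect = solve-∀
    expansion : norm L (b *ᵥ u +ᵥ (- x) *ᵥ v) ≡ b * (a * b - x * x)
    expansion = begin
      norm L (b *ᵥ u +ᵥ (- x) *ᵥ v)
        ≡⟨ norm-+ᵥ-*ᵥ L b (- x) u v ⟩
      b * (b * a + - x * x) + - x * (b * ⟨ L , v ⟩ u + - x * b)
        ≡⟨ cong (λ y → b * (b * a + - x * x) + - x * (b * y + - x * b)) (⟨⟩-sym L (proj₁ pd) v u) ⟩
      b * (b * a + - x * x) + - x * (b * x + - x * b)
        ≡⟨ collect a b x ⟩
      b * (a * b - x * x) ∎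

-- Vectors orthogonal to a rational spanning set

fromℤ : ℤ → ℚ
fromℤ z = z ℚ./ 1

-- z / 1 is already in lowest terms, so + and * of such rationals reduce to the integer operations.
fromℤ≡mkℚ : ∀ z → fromℤ z ≡ mkℚ z 0 (Coprimality.sym (Coprimality.1-coprimeTo _))
fromℤ≡mkℚ z = ℚ.↥p/↧p≡p (mkℚ z 0 (Coprimality.sym (Coprimality.1-coprimeTo _)))

fromℤ-+ : ∀ a b → fromℤ (a + b) ≡ fromℤ a ℚ.+ fromℤ b
fromℤ-+ a b = sym (trans (cong₂ ℚ._+_ (fromℤ≡mkℚ a) (fromℤ≡mkℚ b))
                         (cong (ℚ._/ 1) (cong₂ _+_ (ℤ.*-identityʳ a) (ℤ.*-identityʳ b))))

fromℤ-* : ∀ a b → fromℤ (a * b) ≡ fromℤ a ℚ.* fromℤ b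
fromℤ-* a b = sym (cong₂ ℚ._*_ (fromℤ≡mkℚ a) (fromℤ≡mkℚ b))

fromℤ≡0⇒≡0 : ∀ z → fromℤ z ≡ 0ℚ → z ≡ + 0
fromℤ≡0⇒≡0 z eq = trans (sym (cong ℚ.↥_ (fromℤ≡mkℚ z))) (cong ℚ.↥_ eq)

pairℚ : ∀ {n} → Vec ℚ n → Vector n → ℚ
pairℚ []      []      = 0ℚ
pairℚ (a ∷ x) (b ∷ z) = a ℚ.* fromℤ b ℚ.+ pairℚ x z

pairℚ-distrib-+ : ∀ {n} (x y : Vec ℚ n) z → pairℚ (zipWith ℚ._+_ x y) z ≡ pairℚ x z ℚ.+ pairℚ y z
pairℚ-distrib-+ []      []      []      = sym (ℚ.+-identityʳ 0ℚ)
pairℚ-distrib-+ (a ∷ x) (b ∷ y) (e ∷ z) =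
  trans (cong (ℚ._+_ ((a ℚ.+ b) ℚ.* fromℤ e)) (pairℚ-distrib-+ x y z)) (shuffle a b (fromℤ e) _ _)
  where
  open +-*-Solver
  shuffle : ∀ a b e r s → (a ℚ.+ b) ℚ.* e ℚ.+ (r ℚ.+ s) ≡ (a ℚ.* e ℚ.+ r) ℚ.+ (b ℚ.* e ℚ.+ s)
  shuffle = solve 5 (λ a b e r s → (a :+ b) :* e :+ (r :+ s) := (a :* e :+ r) :+ (b :* e :+ s)) refl

pairℚ-scale : ∀ {n} c (x : Vec ℚ n) z → pairℚ (map (c ℚ.*_) x) z ≡ c ℚ.* pairℚ x z
pairℚ-scale c []      []      = sym (ℚ.*-zeroʳ c)
pairℚ-scale c (a ∷ x) (e ∷ z) =
  trans (cong (ℚ._+_ (c ℚ.* a ℚ.* fromℤ e)) (pairℚ-scale c x z)) (factor c a (fromℤ e) _)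
  where
  open +-*-Solver
  factor : ∀ c a e r → c ℚ.* a ℚ.* e ℚ.+ c ℚ.* r ≡ c ℚ.* (a ℚ.* e ℚ.+ r)
  factor = solve 4 (λ c a e r → c :* a :* e :+ c :* r := c :* (a :* e :+ r)) refl

pairℚ-zeroˡ : ∀ {n} (z : Vector n) → pairℚ (replicate n 0ℚ) z ≡ 0ℚ
pairℚ-zeroˡ []      = refl
pairℚ-zeroˡ (e ∷ z) = trans (cong₂ ℚ._+_ (ℚ.*-zeroˡ (fromℤ e)) (pairℚ-zeroˡ z)) (ℚ.+-identityʳ 0ℚ)

pairℚ-toℚ : ∀ {n} (x z : Vector n) → pairℚ (toℚ x) z ≡ fromℤ (dot x z)
pairℚ-toℚ []      []      = refl
pairℚ-toℚ (a ∷ x) (b ∷ z) = begin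
  fromℤ a ℚ.* fromℤ b ℚ.+ pairℚ (toℚ x) z   ≡⟨ cong₂ ℚ._+_ (sym (fromℤ-* a b)) (pairℚ-toℚ x z) ⟩
  fromℤ (a * b) ℚ.+ fromℤ (dot x z)          ≡⟨ fromℤ-+ (a * b) (dot x z) ⟨
  fromℤ (a * b + dot x z)                    ∎

pairℚ-linComb : ∀ {n m} (c : Vec ℚ m) (vs : Vec (Vector n) m) z →
  (∀ i → dot (lookup vs i) z ≡ + 0) → pairℚ (linComb c vs) z ≡ 0ℚ
pairℚ-linComb []      []       z _    = pairℚ-zeroˡ z
pairℚ-linComb (c ∷ cs) (v ∷ vs) z v⊥z = begin
  pairℚ (zipWith ℚ._+_ (map (c ℚ.*_) (toℚ v)) (linComb cs vs)) z
    ≡⟨ pairℚ-distrib-+ (map (c ℚ.*_) (toℚ v)) (linComb cs vs) z ⟩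
  pairℚ (map (c ℚ.*_) (toℚ v)) z ℚ.+ pairℚ (linComb cs vs) z
    ≡⟨ cong₂ ℚ._+_ (pairℚ-scale c (toℚ v) z) (pairℚ-linComb cs vs z (v⊥z ∘ Fin.suc)) ⟩
  c ℚ.* pairℚ (toℚ v) z ℚ.+ 0ℚ
    ≡⟨ cong (λ q → c ℚ.* q ℚ.+ 0ℚ) (trans (pairℚ-toℚ v z) (cong fromℤ (v⊥z Fin.zero))) ⟩
  c ℚ.* 0ℚ ℚ.+ 0ℚ
    ≡⟨ trans (ℚ.+-identityʳ _) (ℚ.*-zeroʳ c) ⟩
  0ℚ ∎

Spans : ∀ {n m} → Vec (Vector n) m → Set
Spans {n} vs = ∀ (w : Vec ℚ n) → ∃[ c ] (linComb c vs ≡ w)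

module _ {n m} {L : Lattice n} {vs : Vec (Vector n) m} (spans : Spans vs) where

  orthogonal-to-spanning⇒norm≡0 : ∀ d → (∀ i → ⟨ L , lookup vs i ⟩ d ≡ + 0) → norm L d ≡ + 0
  orthogonal-to-spanning⇒norm≡0 d vs⊥d with spans (toℚ d)
  ... | c , linComb≡d = fromℤ≡0⇒≡0 (norm L d) (begin
    fromℤ (dot d (gram L · d))           ≡⟨ pairℚ-toℚ d (gram L · d) ⟨
    pairℚ (toℚ d) (gram L · d)           ≡⟨ cong (λ x → pairℚ x (gram L · d)) linComb≡d ⟨
    pairℚ (linComb c vs) (gram L · d)    ≡⟨ pairℚ-linComb c vs (gram L · d) vs⊥d ⟩
    0ℚ                                   ∎)

module _ {n m} {L : Lattice n} (pd : IsPositiveDefinite L) {vs : Vec (Vector n) m} (spans : Spans vs) where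

  orthogonal-to-spanning⇒≡zero : ∀ d → (∀ i → ⟨ L , lookup vs i ⟩ d ≡ + 0) → d ≡ zeroVec
  orthogonal-to-spanning⇒≡zero d vs⊥d with Vec.≡-dec ℤ._≟_ d zeroVec
  ... | yes d≡0 = d≡0
  ... | no  d≢0 = contradiction (proj₂ pd d d≢0) (ℤ.<-irrefl (sym (orthogonal-to-spanning⇒norm≡0 spans d vs⊥d)))

  isometry-fixing-spanning-set≗id : (f : Vector n → Vector n) → (∀ u v → ⟨ L , f u ⟩ (f v) ≡ ⟨ L , u ⟩ v) →
    (∀ i → f (lookup vs i) ≡ lookup vs i) → ∀ e → f e ≡ e
  isometry-fixing-spanning-set≗id f f-isometry f-fixes e =
    u-ᵥv≡0⇒u≡v (f e) e (orthogonal-to-spanning⇒≡zero (f e -ᵥ e) vs⊥fe-e)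
    where
    cancel : ∀ x → x + - + 1 * x ≡ + 0
    cancel = solve-∀
    vs⊥fe-e : ∀ i → ⟨ L , lookup vs i ⟩ (f e -ᵥ e) ≡ + 0
    vs⊥fe-e i = let v = lookup vs i in begin
      ⟨ L , v ⟩ (f e -ᵥ e)                      ≡⟨ ⟨⟩-distribʳ-+ᵥ L v (f e) (-ᵥ e) ⟩
      ⟨ L , v ⟩ (f e) + ⟨ L , v ⟩ (-ᵥ e)        ≡⟨ cong₂ _+_ (cong (λ u → ⟨ L , u ⟩ (f e)) (sym (f-fixes i))) (⟨⟩-*ᵥʳ L (- + 1) v e) ⟩
      ⟨ L , f v ⟩ (f e) + - + 1 * ⟨ L , v ⟩ e   ≡⟨ cong (_+ - + 1 * ⟨ L , v ⟩ e) (f-isometry v e) ⟩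
      ⟨ L , v ⟩ e + - + 1 * ⟨ L , v ⟩ e         ≡⟨ cancel (⟨ L , v ⟩ e) ⟩
      + 0                                        ∎

-- Finiteness of Min(L)

∈↔Fin-length : ∀ {X : Set} (ys : List X) → Σ X (_∈ ys) ↔ Fin (length ys)
∈↔Fin-length ys = mk↔ₛ′ (index ∘ proj₂) (λ i → List.lookup ys i , ∈-lookup i) index-lookup (lookup-index ∘ proj₂)
  where
  index-lookup : ∀ {ys : List _} (i : Fin (length ys)) → index (∈-lookup {xs = ys} i) ≡ i
  index-lookup {_ ∷ _} Fin.zero    = refl
  index-lookup {_ ∷ _} (Fin.suc i) = cong Fin.suc (index-lookup i)
  lookup-index : ∀ {ys : List _} {x} (x∈ys : x ∈ ys) → (List.lookup ys (index x∈ys) , ∈-lookup (index x∈ys)) ≡ (x , x∈ys)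
  lookup-index (here refl)  = refl
  lookup-index (there x∈ys) = cong (λ (y , y∈) → y , there y∈) (lookup-index x∈ys)

↔-of-irrelevant-⇔ : ∀ {A B : Set} → Irrelevant A → Irrelevant B → (A → B) → (B → A) → A ↔ B
↔-of-irrelevant-⇔ A-irr B-irr to from = mk↔ₛ′ to from (λ _ → B-irr _ _) (λ _ → A-irr _ _)

module _ {X : Set} (_≟_ : DecidableEquality X) {Q : X → Set} (Q? : Pred.Decidable Q)
         (Q-irr : ∀ {x} → Irrelevant (Q x)) where

  covered⇒finite : ∀ xs → (∀ {x} → Q x → x ∈ xs) → ∃[ m ] (Σ X Q ↔ Fin m)
  covered⇒finite xs cover = length ys , ↔-trans Q↔∈ys (∈↔Fin-length ys)
    where
    ys = deduplicate _≟_ (filter Q? xs)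
    Q↔∈ys : Σ X Q ↔ Σ X (_∈ ys)
    Q↔∈ys = Σ-↔ ↔-refl (↔-of-irrelevant-⇔ Q-irr (unique⇒irrelevant (Unique.deduplicate-! _≟_ (filter Q? xs)))
                           (λ q → ∈-deduplicate⁺ _≟_ (∈-filter⁺ Q? {xs = xs} (cover q) q))
                           (λ x∈ys → proj₂ (∈-filter⁻ Q? {xs = xs} (∈-deduplicate⁻ _≟_ (filter Q? xs) x∈ys))))

i*i≤j⇒∣i∣≤∣j∣ : ∀ i j → i * i ≤ j → ∣ i ∣ ℕ.≤ ∣ j ∣
i*i≤j⇒∣i∣≤∣j∣ i j i*i≤j = ℕ.≤-trans (m≤m*m ∣ i ∣) (drop (subst (_≤ j) (square i) i*i≤j))
  where
  m≤m*m : ∀ m → m ℕ.≤ m ℕ.* m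
  m≤m*m zero    = z≤n
  m≤m*m (suc m) = ℕ.m≤m*n (suc m) (suc m)
  square : ∀ i → i * i ≡ + (∣ i ∣ ℕ.* ∣ i ∣)
  square (+ m)    = ℤ.+◃n≡+n (m ℕ.* m)
  square -[1+ m ] = ℤ.+◃n≡+n (suc m ℕ.* suc m)
  drop : ∀ {m} → + m ≤ j → m ℕ.≤ ∣ j ∣
  drop (ℤ.+≤+ m≤n) = m≤n

integersUpTo : ℕ → List ℤ
integersUpTo b = List.map +_ (upTo (suc b)) ++ List.map (λ k → - + k) (upTo (suc b))

∈-integersUpTo : ∀ {i b} → ∣ i ∣ ℕ.≤ b → i ∈ integersUpTo b
∈-integersUpTo {+ k}      {b} k≤b = ∈-++⁺ˡ (∈-map⁺ +_ (∈-upTo⁺ (s≤s k≤b)))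
∈-integersUpTo { -[1+ k ]} {b} k<b = ∈-++⁺ʳ (List.map +_ (upTo (suc b))) (∈-map⁺ (λ k → - + k) (∈-upTo⁺ (s≤s k<b)))

box : ∀ {n} → Vec ℕ n → List (Vector n)
box []       = [ [] ]
box (b ∷ bs) = cartesianProductWith _∷_ (integersUpTo b) (box bs)

∈-box : ∀ {n} (bs : Vec ℕ n) (v : Vector n) → (∀ i → ∣ lookup v i ∣ ℕ.≤ lookup bs i) → v ∈ box bs
∈-box []       []      _     = here refl
∈-box (b ∷ bs) (x ∷ v) v≤bs =
  ∈-cartesianProductWith⁺ _∷_ (∈-integersUpTo (v≤bs Fin.zero)) (∈-box bs v (v≤bs ∘ Fin.suc))

MinWithProduct : ∀ {n} → Lattice n → Vector n → ℤ → Vector n → Set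
MinWithProduct L v c w = InMin L w × ⟨ L , v ⟩ w ≡ c

MinWithProduct-irrelevant : ∀ {n} (L : Lattice n) v c {w} → Irrelevant (MinWithProduct L v c w)
MinWithProduct-irrelevant L v c (p , q) (p′ , q′) = cong₂ _,_ (≡-irrelevant p p′) (≡-irrelevant q q′)

module _ {n} (L : Lattice n) where

  norm-ᵥ : ∀ w → norm L (-ᵥ w) ≡ norm L w
  norm-ᵥ w = trans (⟨⟩-*ᵥˡ L (- + 1) w (-ᵥ w))
                   (trans (cong (- + 1 *_) (⟨⟩-*ᵥʳ L (- + 1) w w)) (-1*-involutive (norm L w)))

  MinWithProduct-negate : ∀ v c → Σ _ (MinWithProduct L v (- c)) ↔ Σ _ (MinWithProduct L v c)
  MinWithProduct-negate v c =
    Σ-↔ -ᵥ↔ (↔-of-irrelevant-⇔ (MinWithProduct-irrelevant L v (- c)) (MinWithProduct-irrelevant L v c) to from)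
    where
    negate : ∀ x y → x ≡ - y → - + 1 * x ≡ y
    negate x y refl = trans (cong (- + 1 *_) (sym (-1*i≡-i y))) (-1*-involutive y)
    negate⁻ : ∀ x y → - + 1 * x ≡ y → x ≡ - y
    negate⁻ x y refl = trans (sym (-1*-involutive x)) (-1*i≡-i (- + 1 * x))
    to : ∀ {w} → MinWithProduct L v (- c) w → MinWithProduct L v c (-ᵥ w)
    to {w} (w∈Min , ⟨v,w⟩≡-c) =
      trans (norm-ᵥ w) w∈Min , trans (⟨⟩-*ᵥʳ L (- + 1) v w) (negate _ c ⟨v,w⟩≡-c)
    from : ∀ {w} → MinWithProduct L v c (-ᵥ w) → MinWithProduct L v (- c) w
    from {w} (-w∈Min , ⟨v,-w⟩≡c) =
      trans (sym (norm-ᵥ w)) -w∈Min , negate⁻ _ c (trans (sym (⟨⟩-*ᵥʳ L (- + 1) v w)) ⟨v,-w⟩≡c)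

module _ {n} {L : Lattice n} (pd : IsPositiveDefinite L) (unimodular : IsUnimodular L) where

  private
    H = proj₁ unimodular

  minBounds : Vec ℕ n
  minBounds = tabulate λ i → ∣ norm L (lookup H i) * + 6 ∣

  Min⊆box : ∀ {w} → InMin L w → w ∈ box minBounds
  Min⊆box {w} w∈Min = ∈-box minBounds w bounded
    where
    0<norm-w : + 0 < norm L w
    0<norm-w = subst (+ 0 <_) (sym w∈Min) (ℤ.+<+ (s≤s z≤n))
    bounded : ∀ i → ∣ lookup w i ∣ ℕ.≤ lookup minBounds i
    bounded i = subst₂ ℕ._≤_ (cong ∣_∣ (sym (coordinate-via-inverse L H (proj₂ (proj₂ unimodular)) w i)))
                             (sym (Vec.lookup∘tabulate _ i))
                             (i*i≤j⇒∣i∣≤∣j∣ (⟨ L , h ⟩ w) (norm L h * + 6) product-bound)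
      where
      h = lookup H i
      product-bound : ⟨ L , h ⟩ w * ⟨ L , h ⟩ w ≤ norm L h * + 6
      product-bound = subst (λ t → ⟨ L , h ⟩ w * ⟨ L , h ⟩ w ≤ norm L h * t) w∈Min (cauchy-schwarz pd h w 0<norm-w)

  MinWithProduct-finite : ∀ v c → ∃[ m ] (Σ _ (MinWithProduct L v c) ↔ Fin m)
  MinWithProduct-finite v c =
    covered⇒finite (Vec.≡-dec ℤ._≟_) (λ w → (norm L w ℤ.≟ + 6) ×-dec (⟨ L , v ⟩ w ℤ.≟ c))
      (MinWithProduct-irrelevant L v c)
      (box minBounds) (Min⊆box ∘ proj₁)

  PairSet↔MinWithProduct±k : ∀ v k →
    PairSet L v k ↔ (Σ _ (MinWithProduct L v (+ k)) ⊎ Σ _ (MinWithProduct L v (- + k)))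
  PairSet↔MinWithProduct±k v k = ↔-trans (Σ-↔ ↔-refl ×-distribˡ-⊎) Σ-distribˡ-⊎

  -- Negation exchanges the two halves, so |PairSet L v k| is even.
  aₖ-exists : ∀ v k → ∃[ m ] aₖ≡ L k v m
  aₖ-exists v k = m , ↔-trans (PairSet↔MinWithProduct±k v k) (↔-trans halves (↔-sym Fin+Fin))
    where
    m = proj₁ (MinWithProduct-finite v (+ k))
    finite : Σ _ (MinWithProduct L v (+ k)) ↔ Fin m
    finite = proj₂ (MinWithProduct-finite v (+ k))
    halves : (Σ _ (MinWithProduct L v (+ k)) ⊎ Σ _ (MinWithProduct L v (- + k))) ↔ (Fin m ⊎ Fin m)
    halves = finite ⊎-↔ ↔-trans (MinWithProduct-negate L v (+ k)) finite
    Fin+Fin : Fin (2 ℕ.* m) ↔ (Fin m ⊎ Fin m)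
    Fin+Fin = subst (λ t → Fin (m ℕ.+ t) ↔ (Fin m ⊎ Fin m)) (sym (ℕ.+-identityʳ m)) Fin.+↔⊎

-- Isometries preserve intersection patterns

record Isometry {n} (L : Lattice n) : Set where
  field
    bijection : Vector n ↔ Vector n

  apply : Vector n → Vector n
  apply = Inverse.to bijection

  unapply : Vector n → Vector n
  unapply = Inverse.from bijection

  field
    preserves : ∀ u v → ⟨ L , apply u ⟩ (apply v) ≡ ⟨ L , u ⟩ v

open Isometry

module _ {n} {L : Lattice n} where

  isometry-id : Isometry L
  isometry-id = record { bijection = ↔-refl ; preserves = λ _ _ → refl }

  _∘ᵢ_ : Isometry L → Isometry L → Isometry L
  φ ∘ᵢ ψ = record
    { bijection = ↔-trans (bijection ψ) (bijection φ)
    ; preserves = λ u v → trans (preserves φ (apply ψ u) (apply ψ v)) (preserves ψ u v)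
    }

  isometry-inverse : Isometry L → Isometry L
  isometry-inverse φ = record
    { bijection = ↔-sym (bijection φ)
    ; preserves = λ u v → begin
        ⟨ L , unapply φ u ⟩ (unapply φ v)                    ≡⟨ preserves φ (unapply φ u) (unapply φ v) ⟨
        ⟨ L , apply φ (unapply φ u) ⟩ (apply φ (unapply φ v)) ≡⟨ cong₂ (λ x y → ⟨ L , x ⟩ y) (inverseˡ u) (inverseˡ v) ⟩
        ⟨ L , u ⟩ v                                          ∎
    }
    where
    inverseˡ : ∀ u → apply φ (unapply φ u) ≡ u
    inverseˡ = Inverse.strictlyInverseˡ (bijection φ)

  InO⇒isometry : ∀ {A} → InO L A → Isometry L
  InO⇒isometry {A} ((B , AB≡I , BA≡I) , A-preserves) = record
    { bijection = mk↔ₛ′ (A ·_) (B ·_) (inverse-cancel A B AB≡I) (inverse-cancel B A BA≡I)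
    ; preserves = A-preserves
    }

cong₂-↔ : ∀ {A B : Set} (F : A → B → Set) {a a′ b b′} → a ≡ a′ → b ≡ b′ → F a b ↔ F a′ b′
cong₂-↔ F refl refl = ↔-refl

module _ {n} {L : Lattice n} (φ : Isometry L) where

  PairSet-isometry : ∀ v k → PairSet L v k ↔ PairSet L (apply φ v) k
  PairSet-isometry v k = Σ-↔ (bijection φ) λ {w} →
    cong₂-↔ (λ a b → a ≡ + 6 × (b ≡ + k ⊎ b ≡ - + k)) (sym (preserves φ w w)) (sym (preserves φ v w))

  In𝒜-isometry : IsPositiveDefinite L → IsUnimodular L → ∀ v → InMin L v → In𝒜 L v (apply φ v)
  In𝒜-isometry pd unimodular v v∈Min = trans (preserves φ v v) v∈Min , λ k _ _ →
    let m , v-count = aₖ-exists pd unimodular v k in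
    m , ↔-trans (↔-sym (PairSet-isometry v k)) v-count , v-count

module _ {n} {L : Lattice (suc n)} (pd : IsPositiveDefinite L) (unimodular : IsUnimodular L)
         {Γ : Matrix (suc n) → Set} {vs : Vec (Vector (suc n)) (suc n)}
         (rigidifying : IsRigidifyingBasis L Γ vs) where

  private
    vs⊆Min = proj₁ rigidifying
    vs-spans = proj₂ (proj₁ (proj₂ rigidifying))
    vs-rigid = proj₂ (proj₂ (proj₂ rigidifying))

  isometry-fixing-v₀-fixes-basis : (φ : Isometry L) → apply φ (lookup vs Fin.zero) ≡ lookup vs Fin.zero →
    ∀ i → apply φ (lookup vs i) ≡ lookup vs i
  isometry-fixing-v₀-fixes-basis φ φv₀≡v₀ = All.wfRec Fin.<-wellFounded 0ℓ Fixed step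
    where
    Fixed : Fin (suc n) → Set
    Fixed i = apply φ (lookup vs i) ≡ lookup vs i
    step : ∀ i → (∀ {j} → j Fin.< i → Fixed j) → Fixed i
    step Fin.zero    _      = φv₀≡v₀
    step (Fin.suc i) fixed< =
      vs-rigid (Fin.suc i) (s≤s z≤n) (apply φ vᵢ) (In𝒜-isometry φ pd unimodular vᵢ (vs⊆Min (Fin.suc i)))
        λ j j<i → let vⱼ = lookup vs j in begin
          ⟨ L , apply φ vᵢ ⟩ vⱼ               ≡⟨ cong (⟨ L , apply φ vᵢ ⟩) (fixed< j<i) ⟨
          ⟨ L , apply φ vᵢ ⟩ (apply φ vⱼ)     ≡⟨ preserves φ vᵢ vⱼ ⟩
          ⟨ L , vᵢ ⟩ vⱼ                       ∎
      where vᵢ = lookup vs (Fin.suc i)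

  isometries-agreeing-on-v₀-agree : (φ ψ : Isometry L) → apply φ (lookup vs Fin.zero) ≡ apply ψ (lookup vs Fin.zero) →
    ∀ e → apply φ e ≡ apply ψ e
  isometries-agreeing-on-v₀-agree φ ψ φv₀≡ψv₀ e = begin
    apply φ e                   ≡⟨ Inverse.strictlyInverseˡ (bijection ψ) (apply φ e) ⟨
    apply ψ (apply χ e)         ≡⟨ cong (apply ψ) (χ≗id e) ⟩
    apply ψ e                   ∎
    where
    χ = isometry-inverse ψ ∘ᵢ φ
    χv₀≡v₀ : apply χ (lookup vs Fin.zero) ≡ lookup vs Fin.zero
    χv₀≡v₀ = trans (cong (unapply ψ) φv₀≡ψv₀) (Inverse.strictlyInverseʳ (bijection ψ) (lookup vs Fin.zero))
    χ≗id : ∀ e → apply χ e ≡ e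
    χ≗id = isometry-fixing-spanning-set≗id pd vs-spans (apply χ) (preserves χ)
             (isometry-fixing-v₀-fixes-basis χ χv₀≡v₀)

rigidifyingBasis⇒O⊆Γ : ∀ {n} (L : Lattice (suc n)) → IsPositiveDefinite L → IsUnimodular L →
  (Γ : Matrix (suc n) → Set) → (∀ A → Γ A → InO L A) →
  ∃[ vs ] IsRigidifyingBasis L Γ vs → ∀ A → InO L A → Γ A
rigidifyingBasis⇒O⊆Γ L pd unimodular Γ Γ⊆O (vs , rigidifying@(vs⊆Min , _ , transitive , _)) A A∈O =
  conclude (transitive Fin.zero refl v₀ (A · v₀) v₀∈𝒜 Av₀∈𝒜)
  where
  v₀ : Vector _
  v₀ = lookup vs Fin.zero
  α : Isometry L
  α = InO⇒isometry A∈O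
  v₀∈𝒜 : In𝒜 L v₀ v₀
  v₀∈𝒜 = In𝒜-isometry isometry-id pd unimodular v₀ (vs⊆Min Fin.zero)
  Av₀∈𝒜 : In𝒜 L v₀ (A · v₀)
  Av₀∈𝒜 = In𝒜-isometry α pd unimodular v₀ (vs⊆Min Fin.zero)
  conclude : ∃[ γ ] (Γ γ × γ · v₀ ≡ A · v₀) → Γ A
  conclude (γ , γ∈Γ , γv₀≡Av₀) = subst Γ γ≡A γ∈Γ
    where
    γ≡A : γ ≡ A
    γ≡A = matrix-ext γ A (isometries-agreeing-on-v₀-agree pd unimodular rigidifying
                            (InO⇒isometry (Γ⊆O γ γ∈Γ)) α γv₀≡Av₀)

proposition3p7 : (L : Lattice 64) → IsExtremalEvenUnimodular64 L →
    (Γ : Matrix 64 → Set) → IsSubgroupO L Γ →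
    ∃[ vs ] IsRigidifyingBasis L Γ vs →
    ∀ (A : Matrix 64) → InO L A → Γ A
proposition3p7 L (pd , _ , unimodular , _) Γ (Γ⊆O , _) = rigidifyingBasis⇒O⊆Γ L pd unimodular Γ Γ⊆O
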